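{- Let $n \ge 2$ be an even integer and $0 \le k \le n-1$. Then \[ S_{n,k} = (n-k)S_{n-1,k-1} + (k+1)S_{n-1,k}, \] where $S_{m,j}=0$ for $j<0$ or $j>m-1$.
   Context: For a permutation $a_1\cdots a_N$ of $[N]=\{1,\dots,N\}$, an ascent is an index $i$ ($1\le i\le N-1$) with $a_i<a_{i+1}$. A permutation is parity-alternate (a PAP) if its consecutive entries alternate between even and odd integers. $S_{N,j}$ denotes the number of PAPs of $[N]$ with exactly $j$ ascents. -}

module Defs where

open import Data.Nat using (ℕ; zero; suc; _+_; _≤_; _<_; _≟_; _≤?_; _<?_; _%_)
open import Data.Nat.Properties using ()
open import Data.Integer using (ℤ; +_; -[1+_])
open import Data.List using (List; []; _∷_; length; map; concatMap; upTo; filter)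
open import Data.List.Relation.Unary.All using (All; all?)
open import Data.List.Relation.Unary.Linked using (Linked; linked?)
open import Data.List.Relation.Unary.Unique.DecPropositional _≟_ using (Unique; unique?)
open import Data.Product using (_×_)
open import Relation.Binary.PropositionalEquality using (_≡_; _≢_)
open import Relation.Nullary using (Dec; does; ¬?)
open import Relation.Nullary.Decidable using (_×-dec_)
open import Data.Bool using (if_then_else_)

InRange : ℕ → ℕ → Set
InRange N x = (1 ≤ x) × (x ≤ N)

IsPermutation : ℕ → List ℕ → Set
IsPermutation N xs = (length xs ≡ N) × All (InRange N) xs × Unique xs

ascents : List ℕ → ℕ
ascents []            = 0
ascents (x ∷ [])      = 0
ascents (x ∷ y ∷ xs)  = (if does (x <? y) then 1 else 0) + ascents (y ∷ xs)

DiffParity : ℕ → ℕ → Set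
DiffParity x y = x % 2 ≢ y % 2

ParityAlternate : List ℕ → Set
ParityAlternate = Linked DiffParity

-- All lists of length l with entries in {1,…,N} (a finite superset of the
-- permutations of [N] when l = N), used only to count.
words : ℕ → ℕ → List (List ℕ)
words N zero    = [] ∷ []
words N (suc l) = concatMap (λ x → map (x ∷_) (words N l)) (map suc (upTo N))

IsPAPWith : ℕ → ℕ → List ℕ → Set
IsPAPWith N j xs = IsPermutation N xs × ParityAlternate xs × (ascents xs ≡ j)

isPAPWith? : ∀ N j xs → Dec (IsPAPWith N j xs)
isPAPWith? N j xs =
  ((length xs ≟ N) ×-dec (all? (λ x → (1 ≤? x) ×-dec (x ≤? N)) xs ×-dec unique? xs))
  ×-dec (linked? (λ x y → ¬? ((x % 2) ≟ (y % 2))) xs ×-dec (ascents xs ≟ j))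

S : ℕ → ℕ → ℕ
S N j = length (filter (isPAPWith? N j) (words N N))

-- Extension to integer indices j, with S N j = 0 for j < 0
-- (for j > N - 1 the count above is already 0).
Sℤ : ℕ → ℤ → ℕ
Sℤ N (+ j)      = S N j
Sℤ N -[1+ j ]   = 0

module Submission where

-- Write n = N + 1 with N = 2j + 1 odd. In a parity-alternate permutation π of [N] the entries at the
-- j + 1 even positions share the parity of the first entry, and [N] contains only j even numbers, so π
-- begins and ends with an odd entry; hence π stays alternating when closed up into a cycle through the
-- even number n. Cutting that cycle open at n identifies the PAPs of [n] with the pairs (π, cut),
-- π = ys ++ zs ↦ zs ++ n ∷ ys; conversely a PAP of [n] has even length, so its ends have different
-- parities and removing n leaves a PAP of [N]. The rotation keeps the ascents of π except a possible one
-- at the cut, and gains the ascent into n unless zs = []: the number of ascents goes up by one at exactly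
-- N − asc π of the N + 1 cuts and stays the same at the other asc π + 1, which with N − (k − 1) = n − k
-- is the recurrence.

open import Defs
open import Data.Nat using (ℕ; zero; suc; _+_; _*_; _∸_; _≤_; _<_; _≟_; _<?_; _≤?_; z≤n; s≤s; _%_; _/_)
open import Data.Nat.Properties
open import Data.Nat.DivMod using (m/n*n≡m; m*n%n≡0; %-distribˡ-+; [m+kn]%n≡m%n)
open import Data.Nat.Divisibility using (_∣_; divides; m%n≡0⇒n∣m)
open import Data.Nat.Tactic.RingSolver using (solve-∀)
open import Data.Integer using (+_; _-_)
open import Data.Maybe as Maybe using (Maybe; just; nothing)
open import Data.Maybe.Relation.Binary.Connected using (Connected; just; just-nothing; nothing-just; nothing)
open import Data.List using (List; []; _∷_; length; map; concatMap; upTo; filter; _++_; head; last)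
open import Data.Nat.ListAction using (sum)
open import Data.List.Properties
  using (length-++; length-++-sucʳ; length-map; length-upTo; map-∘; map-id; map-cong; map-concatMap;
         ++-identityʳ; ∷-injective; ∷-injectiveˡ; ∷-injectiveʳ;
         filter-++; filter-accept; filter-reject; filter-none; filter-≐)
open import Data.List.Membership.Propositional using (_∈_; _∉_; find)
open import Data.List.Membership.Propositional.Properties
  using (∈-map⁺; ∈-map⁻; ∈-++⁺ˡ; ∈-++⁺ʳ; ∈-++⁻; ∈-∃++; ∈-concatMap⁺; ∈-concatMap⁻; ∈-upTo⁺;
         ∈-filter⁺; ∈-filter⁻)
open import Data.List.Membership.DecPropositional _≟_ using (_∈?_)
open import Data.List.Relation.Binary.Subset.Propositional using (_⊆_)
open import Data.List.Relation.Binary.Subset.Propositional.Properties using (filter⁺′)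
open import Data.List.Relation.Binary.Permutation.Propositional using (_↭_; prep; ↭-trans; ↭-sym; ↭⇒↭ₛ)
open import Data.List.Relation.Binary.Permutation.Propositional.Properties
  using (shift; ++-comm; ↭-length; All-resp-↭)
open import Relation.Binary.PropositionalEquality
open import Data.List.Relation.Binary.Permutation.Setoid.Properties (setoid ℕ) using (Unique-resp-↭)
open import Data.List.Relation.Unary.Any as Any using (here; there)
open import Data.List.Relation.Unary.All as All using (All; []; _∷_; all?)
open import Data.List.Relation.Unary.All.Properties as All using ()
open import Data.List.Relation.Unary.Linked as Linked using (Linked; []; [-]; _∷_; _∷′_; linked?)
open import Data.List.Relation.Unary.Linked.Properties using (++⁺)
open import Data.List.Relation.Unary.Unique.Propositional using (Unique; []; _∷_)
open import Data.List.Relation.Unary.Unique.Propositional.Properties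
  using (map⁺; filter⁺; upTo⁺) renaming (++⁺ to ++⁺-unique)
open import Data.List.Relation.Unary.Unique.DecPropositional _≟_ using (unique?)
open import Data.Product using (_×_; _,_; proj₁; proj₂; map₁; map₂)
open import Data.Empty using (⊥; ⊥-elim)
open import Data.Sum using (inj₁; inj₂)
open import Data.Bool using (if_then_else_)
open import Function using (_∘_; id; _⇔_; mk⇔; Equivalence)
open import Relation.Binary using (Rel)
open import Level using (0ℓ)
open import Relation.Nullary using (Dec; yes; no; does; ¬_; ¬?; contradiction)
open import Relation.Nullary.Decidable using (_×-dec_)
open import Relation.Unary using (Decidable)

-- Written like the indicator in the definition of ascents, so that ascents (x ∷ y ∷ ys) unfolds to
-- 𝟙 (x <? y) + ascents (y ∷ ys).
𝟙 : ∀ {p} {P : Set p} → Dec P → ℕ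
𝟙 d = if does d then 1 else 0

𝟙-yes : ∀ {p} {P : Set p} (d : Dec P) → P → 𝟙 d ≡ 1
𝟙-yes (yes _) _  = refl
𝟙-yes (no ¬p) p = contradiction p ¬p

𝟙-no : ∀ {p} {P : Set p} (d : Dec P) → ¬ P → 𝟙 d ≡ 0
𝟙-no (yes p) ¬p = contradiction p ¬p
𝟙-no (no _)  _  = refl

𝟙-*-cong : ∀ {p} {P : Set p} (d : Dec P) {x y} → (P → x ≡ y) → 𝟙 d * x ≡ 𝟙 d * y
𝟙-*-cong (yes p) eq = cong (1 *_) (eq p)
𝟙-*-cong (no _)  _  = refl

𝟙≤1 : ∀ {p} {P : Set p} (d : Dec P) → 𝟙 d ≤ 1
𝟙≤1 (yes _) = s≤s z≤n
𝟙≤1 (no _)  = z≤n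

module _ {A : Set} where

  Unique∧⊆⇒length≤ : ∀ {xs ys : List A} → Unique xs → xs ⊆ ys → length xs ≤ length ys
  Unique∧⊆⇒length≤ {[]}     _            _     = z≤n
  Unique∧⊆⇒length≤ {x ∷ xs} (x∉xs ∷ xs!) xs⊆ys with ∈-∃++ (xs⊆ys (here refl))
  ... | ys₁ , ys₂ , refl = begin
      suc (length xs)           ≤⟨ s≤s (Unique∧⊆⇒length≤ xs! xs⊆ys₁++ys₂) ⟩
      suc (length (ys₁ ++ ys₂)) ≡⟨ length-++-sucʳ ys₁ x ys₂ ⟨
      length (ys₁ ++ x ∷ ys₂)   ∎
    where
    open ≤-Reasoning
    xs⊆ys₁++ys₂ : xs ⊆ ys₁ ++ ys₂
    xs⊆ys₁++ys₂ z∈xs with ∈-++⁻ ys₁ (xs⊆ys (there z∈xs))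
    ... | inj₁ z∈ys₁          = ∈-++⁺ˡ z∈ys₁
    ... | inj₂ (here refl)    = ⊥-elim (All.lookup x∉xs z∈xs refl)
    ... | inj₂ (there z∈ys₂)  = ∈-++⁺ʳ ys₁ z∈ys₂

  Unique∧⊆∧⊇⇒length≡ : ∀ {xs ys : List A} → Unique xs → Unique ys → xs ⊆ ys → ys ⊆ xs → length xs ≡ length ys
  Unique∧⊆∧⊇⇒length≡ xs! ys! xs⊆ys ys⊆xs = ≤-antisym (Unique∧⊆⇒length≤ xs! xs⊆ys) (Unique∧⊆⇒length≤ ys! ys⊆xs)

  unique-map : ∀ {B : Set} (f : A → B) {xs} → (∀ {x y} → x ∈ xs → y ∈ xs → f x ≡ f y → x ≡ y) →
    Unique xs → Unique (map f xs)
  unique-map f {[]}     _   []           = []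
  unique-map f {x ∷ xs} inj (x∉xs ∷ xs!) =
    All.map⁺ (All.tabulate λ y∈xs fx≡fy → All.lookup x∉xs y∈xs (inj (here refl) (there y∈xs) fx≡fy))
    ∷ unique-map f (λ x∈ y∈ → inj (there x∈) (there y∈)) xs!

  unique-concatMap : ∀ {B : Set} (f : A → List B) {xs} → Unique xs → All (Unique ∘ f) xs →
    (∀ {x y v} → x ∈ xs → y ∈ xs → v ∈ f x → v ∈ f y → x ≡ y) → Unique (concatMap f xs)
  unique-concatMap f {[]}     []           []          _       = []
  unique-concatMap f {x ∷ xs} (x∉xs ∷ xs!) (fx! ∷ fxs!) shared⇒≡ =
    ++⁺-unique fx! (unique-concatMap f xs! fxs! (λ x∈ y∈ → shared⇒≡ (there x∈) (there y∈))) disjoint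
    where
    disjoint : ∀ {v} → v ∈ f x × v ∈ concatMap f xs → ⊥
    disjoint (v∈fx , v∈fxs) with find (∈-concatMap⁻ f {xs = xs} v∈fxs)
    ... | y , y∈xs , v∈fy = All.lookup x∉xs y∈xs (shared⇒≡ (here refl) (there y∈xs) v∈fx v∈fy)

  length-filter≡sum-𝟙 : ∀ {P : A → Set} (P? : Decidable P) xs → length (filter P? xs) ≡ sum (map (𝟙 ∘ P?) xs)
  length-filter≡sum-𝟙 P? []       = refl
  length-filter≡sum-𝟙 P? (x ∷ xs) with P? x
  ... | yes _ = cong suc (length-filter≡sum-𝟙 P? xs)
  ... | no  _ = length-filter≡sum-𝟙 P? xs

  length-filter-map : ∀ {B : Set} {P : B → Set} (P? : Decidable P) (f : A → B) xs →
    length (filter P? (map f xs)) ≡ length (filter (P? ∘ f) xs)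
  length-filter-map P? f []       = refl
  length-filter-map P? f (x ∷ xs) with P? (f x)
  ... | yes _ = cong suc (length-filter-map P? f xs)
  ... | no  _ = length-filter-map P? f xs

  length-concatMap : ∀ {B : Set} (f : A → List B) xs → length (concatMap f xs) ≡ sum (map (length ∘ f) xs)
  length-concatMap f []       = refl
  length-concatMap f (x ∷ xs) = trans (length-++ (f x)) (cong (_+_ (length (f x))) (length-concatMap f xs))

  filter-concatMap : ∀ {B : Set} {P : B → Set} (P? : Decidable P) (f : A → List B) xs →
    filter P? (concatMap f xs) ≡ concatMap (filter P? ∘ f) xs
  filter-concatMap P? f []       = refl
  filter-concatMap P? f (x ∷ xs) =
    trans (filter-++ P? (f x) _) (cong (filter P? (f x) ++_) (filter-concatMap P? f xs))

  filter-×-dec : ∀ {P Q : A → Set} (P? : Decidable P) (Q? : Decidable Q) xs →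
    filter (λ x → P? x ×-dec Q? x) xs ≡ filter Q? (filter P? xs)
  filter-×-dec P? Q? []       = refl
  filter-×-dec P? Q? (x ∷ xs) with P? x
  ... | no  _ = filter-×-dec P? Q? xs
  ... | yes _ with Q? x
  ...   | yes _ = cong (x ∷_) (filter-×-dec P? Q? xs)
  ...   | no  _ = filter-×-dec P? Q? xs

  filter-cong : ∀ {P Q : A → Set} (P? : Decidable P) (Q? : Decidable Q) {xs} →
    (∀ {x} → x ∈ xs → P x ⇔ Q x) → filter P? xs ≡ filter Q? xs
  filter-cong P? Q? {[]}     _   = refl
  filter-cong P? Q? {x ∷ xs} P⇔Q with P? x
  ... | yes px with Q? x
  ...   | yes _  = cong (x ∷_) (filter-cong P? Q? (P⇔Q ∘ there))
  ...   | no ¬qx = contradiction (Equivalence.to (P⇔Q (here refl)) px) ¬qx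
  filter-cong P? Q? {x ∷ xs} P⇔Q | no ¬px with Q? x
  ...   | yes qx = contradiction (Equivalence.from (P⇔Q (here refl)) qx) ¬px
  ...   | no _   = filter-cong P? Q? (P⇔Q ∘ there)

  sum-map-cong : ∀ {f g : A → ℕ} {xs} → All (λ x → f x ≡ g x) xs → sum (map f xs) ≡ sum (map g xs)
  sum-map-cong []         = refl
  sum-map-cong (fx≡gx ∷ eqs) = cong₂ _+_ fx≡gx (sum-map-cong eqs)

  sum-map-linear : ∀ a b (f g : A → ℕ) xs →
    sum (map (λ x → a * f x + b * g x) xs) ≡ a * sum (map f xs) + b * sum (map g xs)
  sum-map-linear a b f g []       = sym (cong₂ _+_ (*-zeroʳ a) (*-zeroʳ b))
  sum-map-linear a b f g (x ∷ xs) = begin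
      a * f x + b * g x + sum (map (λ x → a * f x + b * g x) xs)
    ≡⟨ cong (_+_ (a * f x + b * g x)) (sum-map-linear a b f g xs) ⟩
      a * f x + b * g x + (a * F + b * G)
    ≡⟨ distribute a b (f x) (g x) F G ⟩
      a * (f x + F) + b * (g x + G) ∎
    where
    open ≡-Reasoning
    F = sum (map f xs)
    G = sum (map g xs)
    distribute : ∀ a b u v F G → a * u + b * v + (a * F + b * G) ≡ a * (u + F) + b * (v + G)
    distribute = solve-∀

  sum-map-𝟙-linear : ∀ {P Q : A → Set} (P? : Decidable P) (Q? : Decidable Q) a b xs →
    sum (map (λ x → a * 𝟙 (P? x) + b * 𝟙 (Q? x)) xs) ≡ a * length (filter P? xs) + b * length (filter Q? xs)
  sum-map-𝟙-linear P? Q? a b xs = begin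
      sum (map (λ x → a * 𝟙 (P? x) + b * 𝟙 (Q? x)) xs)
    ≡⟨ sum-map-linear a b (𝟙 ∘ P?) (𝟙 ∘ Q?) xs ⟩
      a * sum (map (𝟙 ∘ P?) xs) + b * sum (map (𝟙 ∘ Q?) xs)
    ≡⟨ cong₂ (λ s t → a * s + b * t) (length-filter≡sum-𝟙 P? xs) (length-filter≡sum-𝟙 Q? xs) ⟨
      a * length (filter P? xs) + b * length (filter Q? xs) ∎
    where open ≡-Reasoning

𝟙-bit-split : ∀ a k {e} → e ≤ 1 → 𝟙 (e + a ≟ k) ≡ 𝟙 (suc a ≟ k) * e + 𝟙 (a ≟ k) * (1 ∸ e)
𝟙-bit-split a k z≤n       = sym (cong₂ _+_ (*-zeroʳ (𝟙 (suc a ≟ k))) (*-identityʳ (𝟙 (a ≟ k))))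
𝟙-bit-split a k (s≤s z≤n) =
  sym (trans (cong₂ _+_ (*-identityʳ (𝟙 (suc a ≟ k))) (*-zeroʳ (𝟙 (a ≟ k)))) (+-identityʳ _))

sum-complement-bits : ∀ {ds} → All (_≤ 1) ds → sum (map (1 ∸_) ds) + sum ds ≡ length ds
sum-complement-bits []               = refl
sum-complement-bits (z≤n ∷ bits)     = cong suc (sum-complement-bits bits)
sum-complement-bits {_ ∷ ds} (s≤s z≤n ∷ bits) =
  trans (+-suc (sum (map (1 ∸_) ds)) (sum ds)) (cong suc (sum-complement-bits bits))

length-filter-bits : ∀ a k {ds} → All (_≤ 1) ds →
  length (filter (λ e → e + a ≟ k) ds) ≡ 𝟙 (suc a ≟ k) * sum ds + 𝟙 (a ≟ k) * sum (map (1 ∸_) ds)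
length-filter-bits a k {ds} bits = begin
    length (filter (λ e → e + a ≟ k) ds)
  ≡⟨ length-filter≡sum-𝟙 (λ e → e + a ≟ k) ds ⟩
    sum (map (λ e → 𝟙 (e + a ≟ k)) ds)
  ≡⟨ sum-map-cong (All.map (𝟙-bit-split a k) bits) ⟩
    sum (map (λ e → 𝟙 (suc a ≟ k) * e + 𝟙 (a ≟ k) * (1 ∸ e)) ds)
  ≡⟨ sum-map-linear (𝟙 (suc a ≟ k)) (𝟙 (a ≟ k)) id (1 ∸_) ds ⟩
    𝟙 (suc a ≟ k) * sum (map id ds) + 𝟙 (a ≟ k) * sum (map (1 ∸_) ds)
  ≡⟨ cong (λ t → 𝟙 (suc a ≟ k) * sum t + 𝟙 (a ≟ k) * sum (map (1 ∸_) ds)) (map-id ds) ⟩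
    𝟙 (suc a ≟ k) * sum ds + 𝟙 (a ≟ k) * sum (map (1 ∸_) ds) ∎
  where open ≡-Reasoning

-- Cutting a list and rotating it around a new element

module _ {A : Set} where

  splits : List A → List (List A × List A)
  splits []       = ([] , []) ∷ []
  splits (x ∷ xs) = ([] , x ∷ xs) ∷ map (map₁ (x ∷_)) (splits xs)

  ∈-splits⁻ : ∀ {ys zs} xs → (ys , zs) ∈ splits xs → ys ++ zs ≡ xs
  ∈-splits⁻ []       (here refl) = refl
  ∈-splits⁻ (x ∷ xs) (here refl) = refl
  ∈-splits⁻ (x ∷ xs) (there s∈)  with ∈-map⁻ (map₁ (x ∷_)) s∈
  ... | _ , s∈splits , refl = cong (x ∷_) (∈-splits⁻ xs s∈splits)

  ∈-splits⁺ : ∀ ys zs → (ys , zs) ∈ splits (ys ++ zs)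
  ∈-splits⁺ []       []       = here refl
  ∈-splits⁺ []       (_ ∷ _)  = here refl
  ∈-splits⁺ (x ∷ ys) zs       = there (∈-map⁺ (map₁ (x ∷_)) (∈-splits⁺ ys zs))

  length-splits : ∀ xs → length (splits xs) ≡ suc (length xs)
  length-splits []       = refl
  length-splits (x ∷ xs) = cong suc (trans (length-map (map₁ (x ∷_)) (splits xs)) (length-splits xs))

  splits-unique : ∀ xs → Unique (splits xs)
  splits-unique []       = [] ∷ []
  splits-unique (x ∷ xs) =
    All.map⁺ (All.universal (λ _ ()) (splits xs))
    ∷ map⁺ (λ { {_ , _} {_ , _} refl → refl }) (splits-unique xs)

  rotate : A → List A × List A → List A
  rotate m (ys , zs) = zs ++ m ∷ ys

  ↭-rotate : ∀ m ys zs → rotate m (ys , zs) ↭ m ∷ ys ++ zs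
  ↭-rotate m ys zs = ↭-trans (shift m zs ys) (prep m (++-comm zs ys))

  rotations : A → List A → List (List A)
  rotations m xs = map (rotate m) (splits xs)

  rotate-injective : ∀ {m ys zs ys′ zs′} → m ∉ zs → m ∉ zs′ →
    rotate m (ys , zs) ≡ rotate m (ys′ , zs′) → (ys , zs) ≡ (ys′ , zs′)
  rotate-injective {zs = []}    {zs′ = []}     _    _     eq = cong (_, []) (∷-injectiveʳ eq)
  rotate-injective {zs = []}    {zs′ = _ ∷ _}  _    m∉zs′ eq = contradiction (here (∷-injectiveˡ eq)) m∉zs′
  rotate-injective {zs = _ ∷ _} {zs′ = []}     m∉zs _     eq = contradiction (here (sym (∷-injectiveˡ eq))) m∉zs
  rotate-injective {zs = _ ∷ zs} {zs′ = _ ∷ zs′} m∉zs m∉zs′ eq with ∷-injective eq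
  ... | refl , eq′ with rotate-injective {zs = zs} {zs′ = zs′} (m∉zs ∘ there) (m∉zs′ ∘ there) eq′
  ...   | refl = refl

  last-++-∷ : ∀ xs (y : A) ys → last (xs ++ y ∷ ys) ≡ last (y ∷ ys)
  last-++-∷ []           y ys = refl
  last-++-∷ (x ∷ [])     y ys = refl
  last-++-∷ (x ∷ x′ ∷ xs) y ys = last-++-∷ (x′ ∷ xs) y ys

  module _ {R : Rel A 0ℓ} where

    Linked-++⁻ : ∀ xs {ys} → Linked R (xs ++ ys) → Linked R xs × Linked R ys
    Linked-++⁻ []           Rys        = [] , Rys
    Linked-++⁻ (x ∷ [])     Rxys       = [-] , Linked.tail Rxys
    Linked-++⁻ (x ∷ y ∷ xs) (Rxy ∷ Rys) = map₁ (Rxy ∷_) (Linked-++⁻ (y ∷ xs) Rys)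

    connected-nothingʳ : ∀ u → Connected R u nothing
    connected-nothingʳ (just _) = just-nothing
    connected-nothingʳ nothing  = nothing

    Linked-rotate⁺ : ∀ {m} ys zs → Linked R (ys ++ zs) →
      Connected R (last (ys ++ zs)) (just m) → Connected R (just m) (head (ys ++ zs)) →
      Linked R (rotate m (ys , zs))
    Linked-rotate⁺ ys zs Ryszs last~m m~head =
      ++⁺ Rzs (last-zs zs last~m) (head-ys ys m~head ∷′ Rys)
      where
      Rys = proj₁ (Linked-++⁻ ys Ryszs)
      Rzs = proj₂ (Linked-++⁻ ys Ryszs)
      last-zs : ∀ {m} zs → Connected R (last (ys ++ zs)) (just m) → Connected R (last zs) (just m)
      last-zs []       _ = nothing-just
      last-zs (z ∷ zs) c = subst (λ u → Connected R u _) (last-++-∷ ys z zs) c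
      head-ys : ∀ {m} ys → Connected R (just m) (head (ys ++ zs)) → Connected R (just m) (head ys)
      head-ys []      _ = just-nothing
      head-ys (_ ∷ _) c = c

    Linked-rotate⁻ : ∀ {m} ys zs → Linked R (rotate m (ys , zs)) →
      Connected R (last (rotate m (ys , zs))) (head (rotate m (ys , zs))) → Linked R (ys ++ zs)
    Linked-rotate⁻ {m} ys zs Rσ last~head = ++⁺ (Linked.tail Rm∷ys) (cut ys zs last~head) Rzs
      where
      Rzs   = proj₁ (Linked-++⁻ zs Rσ)
      Rm∷ys = proj₂ (Linked-++⁻ zs Rσ)
      cut : ∀ ys zs → Connected R (last (rotate m (ys , zs))) (head (rotate m (ys , zs))) →
        Connected R (last ys) (head zs)
      cut []       []       _ = nothing
      cut []       (_ ∷ _)  _ = nothing-just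
      cut (y ∷ ys) []       _ = connected-nothingʳ (last (y ∷ ys))
      cut (y ∷ ys) (z ∷ zs) c = subst (λ u → Connected R u (just z)) (last-++-∷ (z ∷ zs) m (y ∷ ys)) c

-- Ascents of rotations

ascentBetween : Maybe ℕ → Maybe ℕ → ℕ
ascentBetween (just a) (just b) = 𝟙 (a <? b)
ascentBetween _        _        = 0

ascentBetween≤1 : ∀ u v → ascentBetween u v ≤ 1
ascentBetween≤1 (just a) (just b) = 𝟙≤1 (a <? b)
ascentBetween≤1 (just _) nothing  = z≤n
ascentBetween≤1 nothing  _        = z≤n

ascents-∷ : ∀ x xs → ascents (x ∷ xs) ≡ ascentBetween (just x) (head xs) + ascents xs
ascents-∷ x []      = refl
ascents-∷ x (_ ∷ _) = refl

ascents-++ : ∀ xs ys → ascents (xs ++ ys) ≡ ascents xs + ascentBetween (last xs) (head ys) + ascents ys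
ascents-++ []            ys = refl
ascents-++ (x ∷ [])      ys = ascents-∷ x ys
ascents-++ (x ∷ x′ ∷ xs) ys =
  trans (cong (_+_ (𝟙 (x <? x′))) (ascents-++ (x′ ∷ xs) ys)) (assoc (𝟙 (x <? x′)) _ _ _)
  where
  assoc : ∀ i a b c → i + (a + b + c) ≡ i + a + b + c
  assoc = solve-∀

ascents-max-∷ : ∀ {m} xs → All (_< m) xs → ascents (m ∷ xs) ≡ ascents xs
ascents-max-∷     []       _         = refl
ascents-max-∷ {m} (x ∷ xs) (x<m ∷ _) = cong (λ t → t + ascents (x ∷ xs)) (𝟙-no (m <? x) (<-asym x<m))

ascentBetween-last-max : ∀ {m} x xs → All (_< m) (x ∷ xs) → ascentBetween (last (x ∷ xs)) (just m) ≡ 1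
ascentBetween-last-max {m} x []       (x<m ∷ _)  = 𝟙-yes (x <? m) x<m
ascentBetween-last-max     x (y ∷ ys) (_ ∷ ys<m) = ascentBetween-last-max y ys ys<m

cutDescent : List ℕ × List ℕ → ℕ
cutDescent (ys , [])     = 0
cutDescent (ys , z ∷ zs) = 1 ∸ ascentBetween (last ys) (just z)

cutDescent≤1 : ∀ s → cutDescent s ≤ 1
cutDescent≤1 (ys , [])     = z≤n
cutDescent≤1 (ys , z ∷ zs) = m∸n≤m 1 (ascentBetween (last ys) (just z))

ascents-rotate : ∀ {m} ys zs → All (_< m) (ys ++ zs) →
  ascents (rotate m (ys , zs)) ≡ cutDescent (ys , zs) + ascents (ys ++ zs)
ascents-rotate ys [] ys<m rewrite ++-identityʳ ys = ascents-max-∷ ys ys<m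
ascents-rotate {m} ys (z ∷ zs) yszs<m = begin
    ascents ((z ∷ zs) ++ m ∷ ys)
  ≡⟨ ascents-++ (z ∷ zs) (m ∷ ys) ⟩
    ascents (z ∷ zs) + ascentBetween (last (z ∷ zs)) (just m) + ascents (m ∷ ys)
  ≡⟨ cong₂ (λ j a → ascents (z ∷ zs) + j + a)
       (ascentBetween-last-max z zs (All.++⁻ʳ ys yszs<m)) (ascents-max-∷ ys (All.++⁻ˡ ys yszs<m)) ⟩
    ascents (z ∷ zs) + 1 + ascents ys
  ≡⟨ cong (λ t → ascents (z ∷ zs) + t + ascents ys) (m∸n+n≡m (ascentBetween≤1 (last ys) (just z))) ⟨
    ascents (z ∷ zs) + ((1 ∸ i) + i) + ascents ys
  ≡⟨ rearrange (ascents (z ∷ zs)) (1 ∸ i) i (ascents ys) ⟩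
    (1 ∸ i) + (ascents ys + i + ascents (z ∷ zs))
  ≡⟨ cong (_+_ (1 ∸ i)) (ascents-++ ys (z ∷ zs)) ⟨
    cutDescent (ys , z ∷ zs) + ascents (ys ++ z ∷ zs) ∎
  where
  open ≡-Reasoning
  i = ascentBetween (last ys) (just z)
  rearrange : ∀ b c i a → b + (c + i) + a ≡ c + (a + i + b)
  rearrange = solve-∀

cutDescents-after : ℕ → List ℕ → List ℕ
cutDescents-after x xs = map (λ s → cutDescent (x ∷ proj₁ s , proj₂ s)) (splits xs)

sum-cutDescents-after : ∀ x xs → sum (cutDescents-after x xs) + ascents (x ∷ xs) ≡ length xs
sum-cutDescents-after x []       = refl
sum-cutDescents-after x (y ∷ ys) = begin
    (1 ∸ i) + sum (map D (map (map₁ (y ∷_)) (splits ys))) + (i + ascents (y ∷ ys))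
  ≡⟨ cong (λ t → (1 ∸ i) + sum t + (i + ascents (y ∷ ys))) drop-head ⟩
    (1 ∸ i) + sum (cutDescents-after y ys) + (i + ascents (y ∷ ys))
  ≡⟨ rearrange (1 ∸ i) _ i _ ⟩
    ((1 ∸ i) + i) + (sum (cutDescents-after y ys) + ascents (y ∷ ys))
  ≡⟨ cong₂ _+_ (m∸n+n≡m (𝟙≤1 (x <? y))) (sum-cutDescents-after y ys) ⟩
    suc (length ys) ∎
  where
  open ≡-Reasoning
  i = 𝟙 (x <? y)
  D = λ s → cutDescent (x ∷ proj₁ s , proj₂ s)
  D-∷ : ∀ s → cutDescent (x ∷ y ∷ proj₁ s , proj₂ s) ≡ cutDescent (y ∷ proj₁ s , proj₂ s)
  D-∷ (_ , [])    = refl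
  D-∷ (_ , _ ∷ _) = refl
  drop-head : map D (map (map₁ (y ∷_)) (splits ys)) ≡ cutDescents-after y ys
  drop-head = trans (sym (map-∘ (splits ys))) (map-cong D-∷ (splits ys))
  rearrange : ∀ c s i a → c + s + (i + a) ≡ (c + i) + (s + a)
  rearrange = solve-∀

sum-cutDescents : ∀ xs → sum (map cutDescent (splits xs)) + ascents xs ≡ length xs
sum-cutDescents []       = refl
sum-cutDescents (x ∷ xs) =
  cong suc (trans (cong (λ t → sum t + ascents (x ∷ xs)) (sym (map-∘ (splits xs))))
                  (sum-cutDescents-after x xs))

cutDescents-bits : ∀ xs → All (_≤ 1) (map cutDescent (splits xs))
cutDescents-bits xs = All.map⁺ (All.universal cutDescent≤1 (splits xs))

sum-cutNonDescents : ∀ xs → sum (map (1 ∸_) (map cutDescent (splits xs))) ≡ suc (ascents xs)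
sum-cutNonDescents xs = +-cancelʳ-≡ (sum ds) _ _ (begin
    sum (map (1 ∸_) ds) + sum ds  ≡⟨ sum-complement-bits (cutDescents-bits xs) ⟩
    length ds                     ≡⟨ trans (length-map cutDescent (splits xs)) (length-splits xs) ⟩
    suc (length xs)               ≡⟨ cong suc (trans (+-comm (ascents xs) (sum ds)) (sum-cutDescents xs)) ⟨
    suc (ascents xs + sum ds)     ∎)
  where
  open ≡-Reasoning
  ds = map cutDescent (splits xs)

length-filter-rotations : ∀ m k xs → All (_< m) xs →
  length (filter (λ σ → ascents σ ≟ k) (rotations m xs))
    ≡ (suc (length xs) ∸ k) * 𝟙 (suc (ascents xs) ≟ k) + suc k * 𝟙 (ascents xs ≟ k)
length-filter-rotations m k xs xs<m = begin
    length (filter (λ σ → ascents σ ≟ k) (map (rotate m) (splits xs)))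
  ≡⟨ length-filter-map (λ σ → ascents σ ≟ k) (rotate m) (splits xs) ⟩
    length (filter (λ s → ascents (rotate m s) ≟ k) (splits xs))
  ≡⟨ cong length (filter-cong (λ s → ascents (rotate m s) ≟ k) (λ s → cutDescent s + a ≟ k) same-count) ⟩
    length (filter (λ s → cutDescent s + a ≟ k) (splits xs))
  ≡⟨ length-filter-map (λ e → e + a ≟ k) cutDescent (splits xs) ⟨
    length (filter (λ e → e + a ≟ k) ds)
  ≡⟨ length-filter-bits a k (cutDescents-bits xs) ⟩
    𝟙 (suc a ≟ k) * sum ds + 𝟙 (a ≟ k) * sum (map (1 ∸_) ds)
  ≡⟨ cong₂ _+_ (𝟙-*-cong (suc a ≟ k) descents)
               (𝟙-*-cong (a ≟ k) (λ a≡k → trans (sum-cutNonDescents xs) (cong suc a≡k))) ⟩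
    𝟙 (suc a ≟ k) * (suc (length xs) ∸ k) + 𝟙 (a ≟ k) * suc k
  ≡⟨ cong₂ _+_ (*-comm (𝟙 (suc a ≟ k)) _) (*-comm (𝟙 (a ≟ k)) _) ⟩
    (suc (length xs) ∸ k) * 𝟙 (suc a ≟ k) + suc k * 𝟙 (a ≟ k) ∎
  where
  open ≡-Reasoning
  a  = ascents xs
  ds = map cutDescent (splits xs)
  same-count : ∀ {s} → s ∈ splits xs → (ascents (rotate m s) ≡ k) ⇔ (cutDescent s + a ≡ k)
  same-count {ys , zs} s∈ = mk⇔ (trans (sym rotated)) (trans rotated)
    where
    rotated : ascents (rotate m (ys , zs)) ≡ cutDescent (ys , zs) + a
    rotated = trans (ascents-rotate ys zs (subst (All (_< m)) (sym (∈-splits⁻ xs s∈)) xs<m))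
                    (cong (λ t → cutDescent (ys , zs) + ascents t) (∈-splits⁻ xs s∈))
  descents : suc a ≡ k → sum ds ≡ suc (length xs) ∸ k
  descents refl = sym (trans (cong (_∸ a) (sym (sum-cutDescents xs))) (m+n∸n≡m (sum ds) a))

-- Permutations

∈-range : ∀ {N x} → InRange N x → x ∈ map suc (upTo N)
∈-range {x = suc x} (_ , x<N) = ∈-map⁺ suc (∈-upTo⁺ x<N)

words-unique : ∀ N l → Unique (words N l)
words-unique N zero    = [] ∷ []
words-unique N (suc l) =
  unique-concatMap (λ x → map (x ∷_) (words N l)) (map⁺ suc-injective (upTo⁺ N))
    (All.universal (λ _ → map⁺ ∷-injectiveʳ (words-unique N l)) _) same-head
  where
  same-head : ∀ {x y v} → _ → _ → v ∈ map (x ∷_) (words N l) → v ∈ map (y ∷_) (words N l) → x ≡ y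
  same-head _ _ v∈x v∈y with ∈-map⁻ _ v∈x | ∈-map⁻ _ v∈y
  ... | _ , _ , refl | _ , _ , x∷w≡y∷w′ = ∷-injectiveˡ x∷w≡y∷w′

∈-words : ∀ N {xs} → All (InRange N) xs → xs ∈ words N (length xs)
∈-words N []                   = here refl
∈-words N {x ∷ xs} (x∈N ∷ xs∈N) =
  ∈-concatMap⁺ (λ y → map (y ∷_) (words N (length xs)))
    (Any.map (λ { refl → ∈-map⁺ (x ∷_) (∈-words N xs∈N) }) (∈-range x∈N))

IsPermutation-resp-↭ : ∀ {N xs ys} → xs ↭ ys → IsPermutation N xs → IsPermutation N ys
IsPermutation-resp-↭ xs↭ys (len , inRange , xs!) =
  trans (sym (↭-length xs↭ys)) len , All-resp-↭ xs↭ys inRange , Unique-resp-↭ (↭⇒↭ₛ xs↭ys) xs!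

IsPermutation-max-∷⁺ : ∀ {N xs} → IsPermutation N xs → IsPermutation (suc N) (suc N ∷ xs)
IsPermutation-max-∷⁺ (len , inRange , xs!) =
  cong suc len ,
  (s≤s z≤n , ≤-refl) ∷ All.map (map₂ m≤n⇒m≤1+n) inRange ,
  All.map (λ (_ , x≤N) 1+N≡x → <-irrefl (sym 1+N≡x) (s≤s x≤N)) inRange ∷ xs!

IsPermutation-max-∷⁻ : ∀ {N xs} → IsPermutation (suc N) (suc N ∷ xs) → IsPermutation N xs
IsPermutation-max-∷⁻ (len , _ ∷ inRange , 1+N∉xs ∷ xs!) =
  suc-injective len ,
  All.zipWith (λ ((1≤x , x≤1+N) , 1+N≢x) → 1≤x , ≤-pred (≤∧≢⇒< x≤1+N (1+N≢x ∘ sym))) (inRange , 1+N∉xs) ,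
  xs!

IsPermutation-rotate⁺ : ∀ {N} ys zs →
  IsPermutation N (ys ++ zs) → IsPermutation (suc N) (rotate (suc N) (ys , zs))
IsPermutation-rotate⁺ ys zs perm = IsPermutation-resp-↭ (↭-sym (↭-rotate _ ys zs)) (IsPermutation-max-∷⁺ perm)

IsPermutation-rotate⁻ : ∀ {N} ys zs →
  IsPermutation (suc N) (rotate (suc N) (ys , zs)) → IsPermutation N (ys ++ zs)
IsPermutation-rotate⁻ ys zs perm = IsPermutation-max-∷⁻ (IsPermutation-resp-↭ (↭-rotate _ ys zs) perm)

max∈ : ∀ {N xs} → IsPermutation (suc N) xs → suc N ∈ xs
max∈ {N} {xs} (len , inRange , xs!) with suc N ∈? xs
... | yes 1+N∈xs = 1+N∈xs
... | no  1+N∉xs = contradiction (Unique∧⊆⇒length≤ xs! xs⊆range) too-long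
  where
  xs⊆range : xs ⊆ map suc (upTo N)
  xs⊆range x∈xs with All.lookup inRange x∈xs
  ... | 1≤x , x≤1+N = ∈-range (1≤x , ≤-pred (≤∧≢⇒< x≤1+N λ { refl → 1+N∉xs x∈xs }))
  too-long : ¬ length xs ≤ length (map suc (upTo N))
  too-long le = <-irrefl refl (subst₂ _≤_ len (trans (length-map suc (upTo N)) (length-upTo N)) le)

-- Parity

DiffParity⇒%2-suc : ∀ x y → DiffParity x y → y % 2 ≡ suc x % 2
DiffParity⇒%2-suc (suc (suc x)) y             x≁y = DiffParity⇒%2-suc x y x≁y
DiffParity⇒%2-suc x             (suc (suc y)) x≁y = DiffParity⇒%2-suc x y x≁y
DiffParity⇒%2-suc zero          zero          x≁y = contradiction refl x≁y
DiffParity⇒%2-suc zero          (suc zero)    _   = refl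
DiffParity⇒%2-suc (suc zero)    zero          _   = refl
DiffParity⇒%2-suc (suc zero)    (suc zero)    x≁y = contradiction refl x≁y

suc-%2≢ : ∀ x → suc x % 2 ≢ x % 2
suc-%2≢ zero          ()
suc-%2≢ (suc zero)    ()
suc-%2≢ (suc (suc x)) = suc-%2≢ x

%2-+-congˡ : ∀ m {y z} → y % 2 ≡ z % 2 → (m + y) % 2 ≡ (m + z) % 2
%2-+-congˡ m {y} {z} y≡z = begin
  (m + y) % 2             ≡⟨ %-distribˡ-+ m y 2 ⟩
  (m % 2 + y % 2) % 2     ≡⟨ cong (λ t → (m % 2 + t) % 2) y≡z ⟩
  (m % 2 + z % 2) % 2     ≡⟨ %-distribˡ-+ m z 2 ⟨
  (m + z) % 2             ∎
  where open ≡-Reasoning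

*2-+-%2 : ∀ j x → (j * 2 + x) % 2 ≡ x % 2
*2-+-%2 j x = trans (cong (_% 2) (+-comm (j * 2) x)) ([m+kn]%n≡m%n x j 2)

last-parity : ∀ {x xs} → ParityAlternate (x ∷ xs) →
  Maybe.map (_% 2) (last (x ∷ xs)) ≡ just ((length xs + x) % 2)
last-parity {xs = []}             _           = refl
last-parity {x}   {xs = y ∷ ys} (x≁y ∷ alt) = trans (last-parity alt) (cong just (begin
  (length ys + y) % 2     ≡⟨ %2-+-congˡ (length ys) {y} {suc x} (DiffParity⇒%2-suc x y x≁y) ⟩
  (length ys + suc x) % 2 ≡⟨ cong (_% 2) (+-suc (length ys) x) ⟩
  suc (length ys + x) % 2 ∎))
  where open ≡-Reasoning

connected-by-parity : ∀ {u c z} → Maybe.map (_% 2) u ≡ just c → c ≢ z % 2 → Connected DiffParity u (just z)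
connected-by-parity {just _} refl c≢z = just c≢z

length-filter-same-parity : ∀ j {x xs} → ParityAlternate (x ∷ xs) → length xs ≡ j * 2 →
  length (filter (λ e → e % 2 ≟ x % 2) (x ∷ xs)) ≡ suc j
length-filter-same-parity zero    {x} {[]}         _                 _   =
  cong length (filter-accept (λ e → e % 2 ≟ x % 2) {x} {[]} refl)
length-filter-same-parity (suc j) {x} {y ∷ z ∷ zs} (x≁y ∷ y≁z ∷ alt) len = begin
    length (filter P? (x ∷ y ∷ z ∷ zs))
  ≡⟨ cong length (filter-accept P? {x} {y ∷ z ∷ zs} refl) ⟩
    suc (length (filter P? (y ∷ z ∷ zs)))
  ≡⟨ cong (suc ∘ length) (filter-reject P? {y} {z ∷ zs} (x≁y ∘ sym)) ⟩
    suc (length (filter P? (z ∷ zs)))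
  ≡⟨ cong suc (subst (λ c → length (filter (λ e → e % 2 ≟ c) (z ∷ zs)) ≡ suc j) z≈x
       (length-filter-same-parity j alt (suc-injective (suc-injective len)))) ⟩
    suc (suc j) ∎
  where
  open ≡-Reasoning
  P? = λ e → e % 2 ≟ x % 2
  z≈x : z % 2 ≡ x % 2
  z≈x = trans (DiffParity⇒%2-suc y z y≁z) (%2-+-congˡ 1 {y} {suc x} (DiffParity⇒%2-suc x y x≁y))

evens : ℕ → List ℕ
evens j = map (λ i → suc i * 2) (upTo j)

∈-evens : ∀ j {e} → InRange (suc (j * 2)) e → e % 2 ≡ 0 → e ∈ evens j
∈-evens j {e} (1≤e , e≤1+2j) e-even with e / 2 | sym (m/n*n≡m (m%n≡0⇒n∣m e 2 e-even))
... | zero  | e≡0 = contradiction (subst (1 ≤_) e≡0 1≤e) λ ()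
... | suc i | e≡2+2i = subst (_∈ evens j) (sym e≡2+2i) (∈-map⁺ (λ i → suc i * 2) (∈-upTo⁺ i<j))
  where
  i<j : i < j
  i<j = *-cancelʳ-< 2 i j (≤-pred (subst (_≤ suc (j * 2)) e≡2+2i e≤1+2j))

length-evens : ∀ j → length (evens j) ≡ j
length-evens j = trans (length-map (λ i → suc i * 2) (upTo j)) (length-upTo j)

head-odd : ∀ j {x xs} → IsPermutation (suc (j * 2)) (x ∷ xs) → ParityAlternate (x ∷ xs) → x % 2 ≢ 0
head-odd j {x} {xs} (len , inRange , x∷xs!) alt x-even = <-irrefl refl (begin
  suc j                            ≡⟨ length-filter-same-parity j alt (suc-injective len) ⟨
  length (filter P? (x ∷ xs))      ≤⟨ Unique∧⊆⇒length≤ (filter⁺ P? x∷xs!) same-parity⊆evens ⟩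
  length (evens j)                 ≡⟨ length-evens j ⟩
  j                                ∎)
  where
  open ≤-Reasoning
  P? = λ e → e % 2 ≟ x % 2
  same-parity⊆evens : filter P? (x ∷ xs) ⊆ evens j
  same-parity⊆evens e∈ with ∈-filter⁻ P? {xs = x ∷ xs} e∈
  ... | e∈x∷xs , e≈x = ∈-evens j (All.lookup inRange e∈x∷xs) (trans e≈x x-even)

odd-PAP-ends : ∀ j {xs} → IsPermutation (suc (j * 2)) xs → ParityAlternate xs →
  Connected DiffParity (last xs) (just (2 + j * 2)) × Connected DiffParity (just (2 + j * 2)) (head xs)
odd-PAP-ends j {x ∷ xs} perm alt =
  connected-by-parity (last-parity alt) (λ last≈n → x-odd (trans (sym last≈x) (trans last≈n n-even))) ,
  just (λ n≈x → x-odd (trans (sym n≈x) n-even))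
  where
  x-odd = head-odd j perm alt
  n-even : (2 + j * 2) % 2 ≡ 0
  n-even = m*n%n≡0 j 2
  last≈x : (length xs + x) % 2 ≡ x % 2
  last≈x = trans (cong (λ l → (l + x) % 2) (suc-injective (proj₁ perm))) (*2-+-%2 j x)

even-alternating-ends : ∀ j {xs} → ParityAlternate xs → length xs ≡ 2 + j * 2 →
  Connected DiffParity (last xs) (head xs)
even-alternating-ends j {x ∷ xs} alt len =
  connected-by-parity (last-parity alt) (λ last≈x → suc-%2≢ x (trans (sym last≈1+x) last≈x))
  where
  last≈1+x : (length xs + x) % 2 ≡ suc x % 2
  last≈1+x = trans (cong (λ l → (l + x) % 2) (suc-injective len)) (%2-+-congˡ 1 {j * 2 + x} {x} (*2-+-%2 j x))

-- Parity-alternate permutations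

IsPAP : ℕ → List ℕ → Set
IsPAP N xs = IsPermutation N xs × ParityAlternate xs

IsPAP-rotate⁺ : ∀ j ys zs → IsPAP (suc (j * 2)) (ys ++ zs) → IsPAP (2 + j * 2) (rotate (2 + j * 2) (ys , zs))
IsPAP-rotate⁺ j ys zs (perm , alt) =
  IsPermutation-rotate⁺ ys zs perm , Linked-rotate⁺ ys zs alt (proj₁ ends) (proj₂ ends)
  where ends = odd-PAP-ends j perm alt

IsPAP-rotate⁻ : ∀ j ys zs → IsPAP (2 + j * 2) (rotate (2 + j * 2) (ys , zs)) → IsPAP (suc (j * 2)) (ys ++ zs)
IsPAP-rotate⁻ j ys zs (perm , alt) =
  IsPermutation-rotate⁻ ys zs perm , Linked-rotate⁻ ys zs alt (even-alternating-ends j alt (proj₁ perm))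

isPermutation? : ∀ N xs → Dec (IsPermutation N xs)
isPermutation? N xs = (length xs ≟ N) ×-dec (all? (λ x → (1 ≤? x) ×-dec (x ≤? N)) xs ×-dec unique? xs)

parityAlternate? : ∀ xs → Dec (ParityAlternate xs)
parityAlternate? = linked? (λ x y → ¬? ((x % 2) ≟ (y % 2)))

PAPs : ℕ → List (List ℕ)
PAPs N = filter parityAlternate? (filter (isPermutation? N) (words N N))

S≡length-filter-PAPs : ∀ N k → S N k ≡ length (filter (λ π → ascents π ≟ k) (PAPs N))
S≡length-filter-PAPs N k = cong length (trans
  (filter-×-dec (isPermutation? N) (λ π → parityAlternate? π ×-dec (ascents π ≟ k)) (words N N))
  (filter-×-dec parityAlternate? (λ π → ascents π ≟ k) (filter (isPermutation? N) (words N N))))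

∈-PAPs⁻ : ∀ {N π} → π ∈ PAPs N → IsPAP N π
∈-PAPs⁻ {N} π∈ with ∈-filter⁻ parityAlternate? {xs = filter (isPermutation? N) (words N N)} π∈
... | π∈perms , alt = proj₂ (∈-filter⁻ (isPermutation? N) {xs = words N N} π∈perms) , alt

∈-PAPs⁺ : ∀ {N π} → IsPAP N π → π ∈ PAPs N
∈-PAPs⁺ {N} {π} (perm@(len , inRange , _) , alt) =
  ∈-filter⁺ parityAlternate?
    (∈-filter⁺ (isPermutation? N) (subst (λ l → π ∈ words N l) len (∈-words N inRange)) perm) alt

PAPs-unique : ∀ N → Unique (PAPs N)
PAPs-unique N = filter⁺ parityAlternate? (filter⁺ (isPermutation? N) (words-unique N N))

module _ (j : ℕ) where
  private
    N n : ℕ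
    N = suc (j * 2)
    n = suc N

  PAPs-⊆-rotations : PAPs n ⊆ concatMap (rotations n) (PAPs N)
  PAPs-⊆-rotations σ∈ with ∈-∃++ (max∈ {N} (proj₁ (∈-PAPs⁻ σ∈)))
  ... | zs , ys , refl = ∈-concatMap⁺ (rotations n)
    (Any.map (λ { refl → ∈-map⁺ (rotate n) (∈-splits⁺ ys zs) })
             (∈-PAPs⁺ (IsPAP-rotate⁻ j ys zs (∈-PAPs⁻ σ∈))))

  rotations-⊆-PAPs : concatMap (rotations n) (PAPs N) ⊆ PAPs n
  rotations-⊆-PAPs σ∈ with find (∈-concatMap⁻ (rotations n) {xs = PAPs N} σ∈)
  ... | π , π∈ , σ∈rotations with ∈-map⁻ (rotate n) σ∈rotations
  ...   | (ys , zs) , s∈ , refl =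
    ∈-PAPs⁺ (IsPAP-rotate⁺ j ys zs (subst (IsPAP N) (sym (∈-splits⁻ π s∈)) (∈-PAPs⁻ π∈)))

  rotations-unique : Unique (concatMap (rotations n) (PAPs N))
  rotations-unique = subst Unique (map-concatMap (rotate n) splits (PAPs N))
    (unique-map (rotate n) (λ s∈ s′∈ → rotate-injective (n∉ s∈) (n∉ s′∈))
      (unique-concatMap splits (PAPs-unique N) (All.universal splits-unique _)
        (λ {π} {π′} _ _ s∈ s∈′ → trans (sym (∈-splits⁻ π s∈)) (∈-splits⁻ π′ s∈′))))
    where
    n∉ : ∀ {ys zs} → (ys , zs) ∈ concatMap splits (PAPs N) → n ∉ zs
    n∉ s∈ n∈zs with find (∈-concatMap⁻ splits {xs = PAPs N} s∈)
    ... | π , π∈ , s∈splits with ∈-PAPs⁻ π∈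
    ...   | (_ , inRange , _) , _ =
      <-irrefl refl (proj₂ (All.lookup inRange (subst (n ∈_) (∈-splits⁻ π s∈splits) (∈-++⁺ʳ _ n∈zs))))

  S≡length-filter-rotations : ∀ k →
    S n k ≡ length (filter (λ σ → ascents σ ≟ k) (concatMap (rotations n) (PAPs N)))
  S≡length-filter-rotations k = trans (S≡length-filter-PAPs n k)
    (Unique∧⊆∧⊇⇒length≡ (filter⁺ A? (PAPs-unique n)) (filter⁺ A? rotations-unique)
      (filter⁺′ A? A? id PAPs-⊆-rotations) (filter⁺′ A? A? id rotations-⊆-PAPs))
    where A? = λ σ → ascents σ ≟ k

  S-recurrence : ∀ k →
    S n k ≡ (n ∸ k) * length (filter (λ π → suc (ascents π) ≟ k) (PAPs N)) + suc k * S N k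
  S-recurrence k = begin
      S n k
    ≡⟨ S≡length-filter-rotations k ⟩
      length (filter A? (concatMap (rotations n) (PAPs N)))
    ≡⟨ cong length (filter-concatMap A? (rotations n) (PAPs N)) ⟩
      length (concatMap (filter A? ∘ rotations n) (PAPs N))
    ≡⟨ length-concatMap (filter A? ∘ rotations n) (PAPs N) ⟩
      sum (map (λ π → length (filter A? (rotations n π))) (PAPs N))
    ≡⟨ sum-map-cong (All.tabulate count) ⟩
      sum (map (λ π → (n ∸ k) * 𝟙 (A-1? π) + suc k * 𝟙 (A? π)) (PAPs N))
    ≡⟨ sum-map-𝟙-linear A-1? A? (n ∸ k) (suc k) (PAPs N) ⟩
      (n ∸ k) * length (filter A-1? (PAPs N)) + suc k * length (filter A? (PAPs N))
    ≡⟨ cong (λ t → (n ∸ k) * length (filter A-1? (PAPs N)) + suc k * t) (S≡length-filter-PAPs N k) ⟨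
      (n ∸ k) * length (filter A-1? (PAPs N)) + suc k * S N k ∎
    where
    open ≡-Reasoning
    A? A-1? : ∀ π → Dec _
    A?   π = ascents π ≟ k
    A-1? π = suc (ascents π) ≟ k
    count : ∀ {π} → π ∈ PAPs N →
      length (filter A? (rotations n π)) ≡ (n ∸ k) * 𝟙 (A-1? π) + suc k * 𝟙 (A? π)
    count {π} π∈ with ∈-PAPs⁻ π∈
    ... | (len , inRange , _) , _ =
      subst (λ l → length (filter A? (rotations n π)) ≡ (suc l ∸ k) * 𝟙 (A-1? π) + suc k * 𝟙 (A? π))
        len (length-filter-rotations n k π (All.map (s≤s ∘ proj₂) inRange))

Sℤ-pred : ∀ N k → Sℤ N (+ k - + 1) ≡ length (filter (λ π → suc (ascents π) ≟ k) (PAPs N))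
Sℤ-pred N zero    =
  sym (cong length (filter-none (λ π → suc (ascents π) ≟ 0) (All.universal (λ _ ()) (PAPs N))))
Sℤ-pred N (suc k) = trans (S≡length-filter-PAPs N k) (cong length
  (filter-≐ (λ π → ascents π ≟ k) (λ π → suc (ascents π) ≟ suc k) (cong suc , suc-injective) (PAPs N)))

corollary5p4 : (n k : ℕ) → 2 ∣ n → 2 ≤ n → k ≤ n ∸ 1 →
    S n k ≡ (n ∸ k) * Sℤ (n ∸ 1) (+ k - + 1) + suc k * Sℤ (n ∸ 1) (+ k)
corollary5p4 .0            k (divides zero    refl) () _
corollary5p4 .(suc j * 2) k (divides (suc j) refl) _  _ = begin
    S n k
  ≡⟨ S-recurrence j k ⟩
    (n ∸ k) * length (filter (λ π → suc (ascents π) ≟ k) (PAPs N)) + suc k * S N k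
  ≡⟨ cong (λ t → (n ∸ k) * t + suc k * S N k) (Sℤ-pred N k) ⟨
    (n ∸ k) * Sℤ N (+ k - + 1) + suc k * S N k ∎
  where
  open ≡-Reasoning
  N n : ℕ
  N = suc (j * 2)
  n = suc N
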